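{- Let $M$ be an abelian group, $P \subseteq M$, and let $B_1 \subseteq B_2 \subseteq M$ be structuring elements that are both symmetric. If $v \in M$ and $B_1 - v \subseteq B_2$, then $B_1 + v \subseteq B_2$. Moreover, $B_1 \subseteq_{S,P,+} B_2$ holds if and only if $B_1 \subseteq_{S,P,- } B_2$ holds.
   Context: A structuring element is a finite set $B$ with $0 \in B \subseteq M$; it is symmetric if $B = -B := \{ -x : x \in B\}$. $A \pm v = \{a \pm v : a \in A\}$. For $x \in P$, $B(x;P,+) = \{ b \in B : x + b \in P\}$, $B(x;P,-) = \{ b \in B : x - b \in P\}$. $B_1 \subseteq_{S,P,+} B_2$: $B_1 \subseteq B_2$ and for every $x \in P$, $b_2 \in B_2(x;P,+)$ there is $b_1 \in B_1(x;P,+)$ with $B_1 + (b_2 - b_1) \subseteq B_2$. $B_1 \subseteq_{S,P,- } B_2$: $B_1 \subseteq B_2$ and for every $x \in P$, $b_2 \in B_2(x;P,-)$ there is $b_1 \in B_1(x;P,-)$ with $B_1 + (b_2 - b_1) \subseteq B_2$. -}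

module Defs where

open import Level using (Level; _⊔_)
open import Algebra.Bundles using (AbelianGroup)
open import Data.List using (List; map)
open import Data.List.Relation.Unary.Any using (Any)
open import Data.Product using (Σ; _×_)
open import Relation.Unary using (Pred)

module SE {c ℓ : Level} (G : AbelianGroup c ℓ) where
  open AbelianGroup G

  -- finite subsets of M, given by an enumerating list
  FinSet : Set c
  FinSet = List Carrier

  _∈ₛ_ : Carrier → FinSet → Set (c ⊔ ℓ)
  x ∈ₛ B = Any (x ≈_) B

  _⊆ₛ_ : FinSet → FinSet → Set (c ⊔ ℓ)
  A ⊆ₛ B = ∀ {x} → x ∈ₛ A → x ∈ₛ B

  _≐_ : FinSet → FinSet → Set (c ⊔ ℓ)
  A ≐ B = (A ⊆ₛ B) × (B ⊆ₛ A)

  neg : FinSet → FinSet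
  neg A = map _⁻¹ A

  _⊕_ : FinSet → Carrier → FinSet
  A ⊕ v = map (λ a → a ∙ v) A

  _⊖_ : FinSet → Carrier → FinSet
  A ⊖ v = map (λ a → a ∙ v ⁻¹) A

  StructuringElement : FinSet → Set (c ⊔ ℓ)
  StructuringElement B = ε ∈ₛ B

  Symmetric : FinSet → Set (c ⊔ ℓ)
  Symmetric B = B ≐ neg B

  InB+ : ∀ {p} → Pred Carrier p → FinSet → Carrier → Carrier → Set (c ⊔ ℓ ⊔ p)
  InB+ P B x b = (b ∈ₛ B) × P (x ∙ b)

  InB- : ∀ {p} → Pred Carrier p → FinSet → Carrier → Carrier → Set (c ⊔ ℓ ⊔ p)
  InB- P B x b = (b ∈ₛ B) × P (x ∙ b ⁻¹)

  SubS+ : ∀ {p} → Pred Carrier p → FinSet → FinSet → Set (c ⊔ ℓ ⊔ p)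
  SubS+ P B₁ B₂ = (B₁ ⊆ₛ B₂) ×
    (∀ x → P x → ∀ b₂ → InB+ P B₂ x b₂ →
       Σ Carrier λ b₁ → InB+ P B₁ x b₁ × ((B₁ ⊕ (b₂ ∙ b₁ ⁻¹)) ⊆ₛ B₂))

  SubS- : ∀ {p} → Pred Carrier p → FinSet → FinSet → Set (c ⊔ ℓ ⊔ p)
  SubS- P B₁ B₂ = (B₁ ⊆ₛ B₂) ×
    (∀ x → P x → ∀ b₂ → InB- P B₂ x b₂ →
       Σ Carrier λ b₁ → InB- P B₁ x b₁ × ((B₁ ⊕ (b₂ ∙ b₁ ⁻¹)) ⊆ₛ B₂))

-- For symmetric B₁, B₂ the group inversion a ↦ a⁻¹ maps B₁ and B₂ onto themselves and
-- sends B₁ + w to -(B₁ + w) = B₁ - w; hence B₁ + w ⊆ B₂ iff B₁ - w ⊆ B₂. The same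
-- inversion turns B(x;P,+) into B(x;P,-) and back, so a witness b₁ for b₂ on one side
-- yields the witness b₁⁻¹ for b₂⁻¹ on the other, and the required containment of
-- B₁ + (b₂⁻¹ - b₁⁻¹) = B₁ - (b₂ - b₁) follows from that of B₁ + (b₂ - b₁).
module Submission where

open import Defs
open import Level using (Level; _⊔_)
open import Algebra.Bundles using (AbelianGroup)
open import Data.Product using (_×_; _,_)
open import Function.Base using (_∘_)
open import Function.Bundles using (_⇔_; mk⇔)
open import Relation.Unary using (Pred)
open import Relation.Binary.Definitions using (_Respects_)
import Algebra.Properties.AbelianGroup as AbelianGroupProperties
import Data.List.Membership.Setoid.Properties as Membership
import Relation.Binary.Reasoning.Setoid as SetoidReasoning

module StructuringElements {c ℓ : Level} (G : AbelianGroup c ℓ) where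
  open AbelianGroup G
  open SE G
  open AbelianGroupProperties G
  open SetoidReasoning setoid

  InverseClosed : FinSet → Set (c ⊔ ℓ)
  InverseClosed B = ∀ {a} → a ∈ₛ B → (a ⁻¹) ∈ₛ B

  symmetric⇒inverseClosed : ∀ {B} → Symmetric B → InverseClosed B
  symmetric⇒inverseClosed (B⊆-B , _) a∈B =
    let b , b∈B , a≈b⁻¹ = Membership.∈-map⁻ setoid setoid (B⊆-B a∈B)
    in Membership.∈-resp-≈ setoid
         (sym (trans (⁻¹-cong a≈b⁻¹) (⁻¹-involutive b))) b∈B

  ⊕-resp-≈ : ∀ {u v} B → u ≈ v → (B ⊕ u) ⊆ₛ (B ⊕ v)
  ⊕-resp-≈ B u≈v y∈B⊕u =
    let a , a∈B , y≈a∙u = Membership.∈-map⁻ setoid setoid y∈B⊕u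
    in Membership.∈-resp-≈ setoid (sym (trans y≈a∙u (∙-congˡ u≈v)))
         (Membership.∈-map⁺ setoid setoid ∙-congʳ a∈B)

  ⊕-⁻¹-⊆ : ∀ {B₁ B₂} → InverseClosed B₁ → InverseClosed B₂ →
           ∀ w → (B₁ ⊕ w) ⊆ₛ B₂ → (B₁ ⊕ (w ⁻¹)) ⊆ₛ B₂
  ⊕-⁻¹-⊆ {B₁} closed₁ closed₂ w B₁⊕w⊆B₂ y∈B₁⊕w⁻¹ =
    let a , a∈B₁ , y≈a∙w⁻¹ = Membership.∈-map⁻ setoid setoid y∈B₁⊕w⁻¹
        a⁻¹∙w∈B₂ = B₁⊕w⊆B₂ (Membership.∈-map⁺ setoid setoid ∙-congʳ (closed₁ a∈B₁))
    in Membership.∈-resp-≈ setoid (sym (trans y≈a∙w⁻¹ (inverse-shift a w)))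
         (closed₂ a⁻¹∙w∈B₂)
    where
    inverse-shift : ∀ a w → a ∙ w ⁻¹ ≈ (a ⁻¹ ∙ w) ⁻¹
    inverse-shift a w = begin
      a ∙ w ⁻¹          ≈⟨ ∙-congʳ (⁻¹-involutive a) ⟨
      a ⁻¹ ⁻¹ ∙ w ⁻¹    ≈⟨ ⁻¹-∙-comm (a ⁻¹) w ⟩
      (a ⁻¹ ∙ w) ⁻¹     ∎

  ⊖-⊆⇒⊕-⊆ : ∀ {B₁ B₂} → InverseClosed B₁ → InverseClosed B₂ →
            ∀ v → (B₁ ⊖ v) ⊆ₛ B₂ → (B₁ ⊕ v) ⊆ₛ B₂
  ⊖-⊆⇒⊕-⊆ {B₁} closed₁ closed₂ v B₁⊖v⊆B₂ =
    ⊕-⁻¹-⊆ closed₁ closed₂ (v ⁻¹) B₁⊖v⊆B₂ ∘ ⊕-resp-≈ B₁ (sym (⁻¹-involutive v))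

  ⊕-shift-⁻¹-⊆ : ∀ {B₁ B₂} → InverseClosed B₁ → InverseClosed B₂ → ∀ b₂ b₁ →
                 (B₁ ⊕ (b₂ ⁻¹ ∙ b₁ ⁻¹)) ⊆ₛ B₂ → (B₁ ⊕ (b₂ ∙ b₁ ⁻¹ ⁻¹)) ⊆ₛ B₂
  ⊕-shift-⁻¹-⊆ {B₁} closed₁ closed₂ b₂ b₁ ⊆B₂ =
    ⊕-⁻¹-⊆ closed₁ closed₂ (b₂ ⁻¹ ∙ b₁ ⁻¹) ⊆B₂ ∘ ⊕-resp-≈ B₁ difference
    where
    difference : b₂ ∙ b₁ ⁻¹ ⁻¹ ≈ (b₂ ⁻¹ ∙ b₁ ⁻¹) ⁻¹
    difference = begin
      b₂ ∙ b₁ ⁻¹ ⁻¹          ≈⟨ ∙-congʳ (⁻¹-involutive b₂) ⟨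
      b₂ ⁻¹ ⁻¹ ∙ b₁ ⁻¹ ⁻¹    ≈⟨ ⁻¹-∙-comm (b₂ ⁻¹) (b₁ ⁻¹) ⟩
      (b₂ ⁻¹ ∙ b₁ ⁻¹) ⁻¹     ∎

  module _ {p} {P : Pred Carrier p} (P-resp : P Respects _≈_) where

    InB+⇒InB-⁻¹ : ∀ {B x b} → InverseClosed B → InB+ P B x b → InB- P B x (b ⁻¹)
    InB+⇒InB-⁻¹ {b = b} closed (b∈B , Px∙b) =
      closed b∈B , P-resp (∙-congˡ (sym (⁻¹-involutive b))) Px∙b

    InB-⇒InB+⁻¹ : ∀ {B x b} → InverseClosed B → InB- P B x b → InB+ P B x (b ⁻¹)
    InB-⇒InB+⁻¹ closed (b∈B , Px∙b⁻¹) = closed b∈B , Px∙b⁻¹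

    module _ {B₁ B₂} (closed₁ : InverseClosed B₁) (closed₂ : InverseClosed B₂) where

      SubS+⇒SubS- : SubS+ P B₁ B₂ → SubS- P B₁ B₂
      SubS+⇒SubS- (B₁⊆B₂ , witness) = B₁⊆B₂ , λ x Px b₂ b₂∈B₂⁻ →
        let b₁ , b₁∈B₁⁺ , shifted = witness x Px (b₂ ⁻¹) (InB-⇒InB+⁻¹ closed₂ b₂∈B₂⁻)
        in b₁ ⁻¹ , InB+⇒InB-⁻¹ closed₁ b₁∈B₁⁺
                 , ⊕-shift-⁻¹-⊆ closed₁ closed₂ b₂ b₁ shifted

      SubS-⇒SubS+ : SubS- P B₁ B₂ → SubS+ P B₁ B₂
      SubS-⇒SubS+ (B₁⊆B₂ , witness) = B₁⊆B₂ , λ x Px b₂ b₂∈B₂⁺ →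
        let b₁ , b₁∈B₁⁻ , shifted = witness x Px (b₂ ⁻¹) (InB+⇒InB-⁻¹ closed₂ b₂∈B₂⁺)
        in b₁ ⁻¹ , InB-⇒InB+⁻¹ closed₁ b₁∈B₁⁻
                 , ⊕-shift-⁻¹-⊆ closed₁ closed₂ b₂ b₁ shifted

proposition3 : ∀ {c ℓ p} (G : AbelianGroup c ℓ) →
    let open AbelianGroup G
        open SE G
    in (P : Pred Carrier p) → P Respects _≈_ →
       (B₁ B₂ : FinSet) →
       StructuringElement B₁ → StructuringElement B₂ → B₁ ⊆ₛ B₂ →
       Symmetric B₁ → Symmetric B₂ →
       (∀ v → (B₁ ⊖ v) ⊆ₛ B₂ → (B₁ ⊕ v) ⊆ₛ B₂) × (SubS+ P B₁ B₂ ⇔ SubS- P B₁ B₂)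
proposition3 G P P-resp B₁ B₂ _ _ _ sym₁ sym₂ =
    ⊖-⊆⇒⊕-⊆ closed₁ closed₂
  , mk⇔ (SubS+⇒SubS- P-resp closed₁ closed₂) (SubS-⇒SubS+ P-resp closed₁ closed₂)
  where
  open StructuringElements G
  closed₁ : InverseClosed B₁
  closed₁ = symmetric⇒inverseClosed sym₁
  closed₂ : InverseClosed B₂
  closed₂ = symmetric⇒inverseClosed sym₂
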